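{- Let $\mathcal{C}$ be a class of $\{0,1\}$-valued functions over a domain $X$, let $f_1,\dots,f_k\in\mathcal{C}$ and $f=f_1\wedge\dots\wedge f_k$. Then for each $i=1,\dots,k$, $$ S_1(f_i,\mathcal{C})\cap M_1(f)\subseteq S_1(f,\mathcal{C}^k). $$
   Context: $M_\nu(f)=\{x\in X: f(x)=\nu\}$. $\mathcal{C}^k$ is the class of functions that can be written as a conjunction of $k$ functions from $\mathcal{C}$. For a class $\mathcal{D}$ and $g\in\mathcal{D}$, a point $x\in X$ is essential for $g$ with respect to $\mathcal{D}$ if there is $h\in\mathcal{D}$ with $h(x)\neq g(x)$ and $h=g$ on $X\setminus\{x\}$; $S(g,\mathcal{D})$ is the set of essential points and $S_\nu(g,\mathcal{D})=S(g,\mathcal{D})\cap M_\nu(g)$. -}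

module Defs where

open import Data.Bool using (Bool; true; false; _∧_)
open import Data.Nat using (ℕ; zero; suc)
open import Data.Fin using (Fin; zero; suc)
open import Data.Product using (Σ; _×_; ∃; ∃-syntax)
open import Relation.Binary.PropositionalEquality using (_≡_; _≢_)
open import Level using (Level; _⊔_)

-- A class of {0,1}-valued functions on X is a predicate on X → Bool
-- (true = 1, false = 0).  Functions are compared pointwise (no funext).

Class : ∀ {a} (ℓ : Level) → Set a → Set (a ⊔ Level.suc ℓ)
Class ℓ X = (X → Bool) → Set ℓ

M : ∀ {a} {X : Set a} → Bool → (X → Bool) → X → Set
M ν f x = f x ≡ ν

conj : ∀ {a} {X : Set a} (k : ℕ) → (Fin k → X → Bool) → X → Bool
conj zero    fs x = true
conj (suc k) fs x = fs zero x ∧ conj k (λ i → fs (suc i)) x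

Pow : ∀ {a ℓ} {X : Set a} → Class ℓ X → ℕ → Class (a ⊔ ℓ) X
Pow C k g = Σ (Fin k → _ → Bool) λ fs → ((i : Fin k) → C (fs i)) × (∀ x → g x ≡ conj k fs x)

Essential : ∀ {a ℓ} {X : Set a} → Class ℓ X → (X → Bool) → X → Set (a ⊔ ℓ)
Essential D g x = Σ (_ → Bool) λ h → D h × (h x ≢ g x) × (∀ y → y ≢ x → h y ≡ g y)

S : ∀ {a ℓ} {X : Set a} → Bool → Class ℓ X → (X → Bool) → X → Set (a ⊔ ℓ)
S ν D g x = Essential D g x × M ν g x

module Submission where

-- Let x ∈ S₁(fᵢ, C) ∩ M₁(f) with f = f₁ ∧ … ∧ fₖ, and let h ∈ C be
-- the witness that x is essential for fᵢ: h agrees with fᵢ off x and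
-- h x ≠ fᵢ x = 1, so h x = 0.  Replacing the i-th conjunct by h gives
-- g = f₁ ∧ … ∧ h ∧ … ∧ fₖ ∈ Cᵏ.  Off x every conjunct of g agrees with the
-- corresponding conjunct of f, hence g agrees with f there; at x the conjunct
-- h vanishes, so g x = 0 ≠ 1 = f x.  Thus g witnesses that x is essential for
-- f with respect to Cᵏ, and f x = 1 puts x in S₁(f, Cᵏ).

open import Defs
open import Data.Bool using (Bool; true; false; _∧_)
open import Data.Bool.Properties using (∧-zeroʳ; ¬-not)
open import Data.Nat using (ℕ; zero; suc)
open import Data.Fin using (Fin; zero; suc; _≟_)
open import Data.Vec.Functional using (updateAt)
open import Data.Vec.Functional.Properties using (updateAt-updates; updateAt-minimal)
open import Data.Product using (_×_; _,_)
open import Function using (const)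
open import Relation.Nullary using (yes; no)
open import Relation.Binary.PropositionalEquality

conj-cong : ∀ {a} {X : Set a} (k : ℕ) (gs fs : Fin k → X → Bool) (y : X) →
  ((j : Fin k) → gs j y ≡ fs j y) → conj k gs y ≡ conj k fs y
conj-cong zero    gs fs y agree = refl
conj-cong (suc k) gs fs y agree =
  cong₂ _∧_ (agree zero) (conj-cong k (λ j → gs (suc j)) (λ j → fs (suc j)) y (λ j → agree (suc j)))

conj-false : ∀ {a} {X : Set a} (k : ℕ) (fs : Fin k → X → Bool) (i : Fin k) (y : X) →
  fs i y ≡ false → conj k fs y ≡ false
conj-false (suc k) fs zero    y fy rewrite fy = refl
conj-false (suc k) fs (suc i) y fy
  rewrite conj-false k (λ j → fs (suc j)) i y fy = ∧-zeroʳ (fs zero y)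

replaceAt : ∀ {a} {X : Set a} {k : ℕ} → (Fin k → X → Bool) → Fin k → (X → Bool) → Fin k → X → Bool
replaceAt fs i h = updateAt fs i (const h)

replaceAt-members : ∀ {a ℓ} {X : Set a} (C : Class ℓ X) {k : ℕ} (fs : Fin k → X → Bool)
  (i : Fin k) (h : X → Bool) → ((j : Fin k) → C (fs j)) → C h →
  (j : Fin k) → C (replaceAt fs i h j)
replaceAt-members C fs i h cs ch j with j ≟ i
... | yes refl = subst C (sym (updateAt-updates i fs)) ch
... | no j≢i   = subst C (sym (updateAt-minimal j i fs j≢i)) (cs j)

conj-replaceAt-agrees : ∀ {a} {X : Set a} (k : ℕ) (fs : Fin k → X → Bool) (i : Fin k)
  (h : X → Bool) (y : X) → h y ≡ fs i y → conj k (replaceAt fs i h) y ≡ conj k fs y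
conj-replaceAt-agrees k fs i h y hy = conj-cong k (replaceAt fs i h) fs y agree
  where
  agree : (j : Fin k) → replaceAt fs i h j y ≡ fs j y
  agree j with j ≟ i
  ... | yes refl = trans (cong (λ g → g y) (updateAt-updates i fs)) hy
  ... | no j≢i   = cong (λ g → g y) (updateAt-minimal j i fs j≢i)

conj-replaceAt-false : ∀ {a} {X : Set a} (k : ℕ) (fs : Fin k → X → Bool) (i : Fin k)
  (h : X → Bool) (y : X) → h y ≡ false → conj k (replaceAt fs i h) y ≡ false
conj-replaceAt-false k fs i h y hy =
  conj-false k (replaceAt fs i h) i y (trans (cong (λ g → g y) (updateAt-updates i fs)) hy)

proposition1 : ∀ {a ℓ} {X : Set a} (C : Class ℓ X) (k : ℕ) (fs : Fin k → X → Bool) →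
    ((i : Fin k) → C (fs i)) →
    (i : Fin k) (x : X) →
    S true C (fs i) x × M true (conj k fs) x →
    S true (Pow C k) (conj k fs) x
proposition1 C k fs cs i x (((h , ch , hx≢fx , agree) , fx≡1) , conjx≡1) =
  (conj k gs , gs∈Cᵏ , g≢f-at-x , g≡f-off-x) , conjx≡1
  where
  gs : Fin k → _ → Bool
  gs = replaceAt fs i h

  gs∈Cᵏ : Pow C k (conj k gs)
  gs∈Cᵏ = gs , replaceAt-members C fs i h cs ch , λ _ → refl

  hx≡0 : h x ≡ false
  hx≡0 = ¬-not (λ hx≡1 → hx≢fx (trans hx≡1 (sym fx≡1)))

  g≢f-at-x : conj k gs x ≢ conj k fs x
  g≢f-at-x g≡f with trans (sym (conj-replaceAt-false k fs i h x hx≡0)) (trans g≡f conjx≡1)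
  ... | ()

  g≡f-off-x : ∀ y → y ≢ x → conj k gs y ≡ conj k fs y
  g≡f-off-x y y≢x = conj-replaceAt-agrees k fs i h y (agree y y≢x)
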